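{- For any integers $k \geqslant 4$ and $d \geqslant k+1$, there exists a Cayley graph that has diameter $k$, degree at most $d$, and order $(k-1)\big(\lfloor\frac{d-k}{2}\rfloor+2\big)^{k-1}$.
   Context: For a group $G$ and a subset $S\subseteq G$ not containing the identity with $S=S^{ -1}$, the Cayley graph of $G$ generated by $S$ is the undirected simple graph with vertex set $G$ in which $g$ and $gs$ are adjacent for all $g\in G$, $s\in S$; it is regular of degree $|S|$ and has order $|G|$. -}

module Defs where

open import Data.Nat using (ℕ; zero; suc; _≤_; _∸_)
open import Data.Fin using (Fin)
open import Data.Fin.Subset using (Subset; _∈_; _∉_)
open import Data.Product using (Σ; ∃; ∃-syntax; _×_)
open import Relation.Nullary using (¬_)
open import Relation.Binary.PropositionalEquality using (_≡_)
open import Algebra.Structures using (IsGroup)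

-- A finite group of order n, presented (up to isomorphism) on the carrier Fin n.
record FiniteGroup (n : ℕ) : Set where
  field
    _·_     : Fin n → Fin n → Fin n
    e       : Fin n
    inv     : Fin n → Fin n
    isGroup : IsGroup _≡_ _·_ e inv

module _ {n : ℕ} (G : FiniteGroup n) where
  open FiniteGroup G

  record IsCayleySet (S : Subset n) : Set where
    field
      e∉S     : e ∉ S
      inv-clo : ∀ s → s ∈ S → inv s ∈ S

  data Walk (S : Subset n) : ℕ → Fin n → Fin n → Set where
    here : ∀ g → Walk S zero g g
    step : ∀ {m g h} s → s ∈ S → Walk S m (g · s) h → Walk S (suc m) g h

  Dist≤ : Subset n → ℕ → Fin n → Fin n → Set
  Dist≤ S m g h = ∃[ j ] (j ≤ m × Walk S j g h)

  HasDiameter : Subset n → ℕ → Set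
  HasDiameter S k =
    (∀ g h → Dist≤ S k g h) × (∃[ g ] ∃[ h ] ¬ Dist≤ S (k ∸ 1) g h)

module Submission where

-- The group is the lamplighter group ℤ/m ≀ ℤ/K with K = k - 1 lamps on a cycle and
-- m = ⌊(d - k)/2⌋ + 2 colours, of order K·mᴷ.  It is generated by the 2(m - 1) moves
-- "add a nonzero colour to the current lamp, then step right", their inverses, and the
-- K - 1 nontrivial rotations of the lamplighter, so |S| ≤ 2⌊(d - k)/2⌋ + k ≤ d.
-- Every element is reached from the identity by K moves, which colour the lamps one
-- after the other (a zero colour is the rotation by one), followed by at most one
-- rotation; hence the diameter is at most K + 1 = k.  For the lower bound, call a
-- configuration aligned if its lit lamps are exactly those below the lamplighter's
-- position p, or exactly those from p on.  The potential "number of lit lamps, plus one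
-- if not aligned" grows by at most one along every edge: a step lights at most one lamp,
-- and when it does light one, an aligned configuration stays aligned.  All lamps lit
-- with the lamplighter at position 1 has potential K + 1, so it lies at distance k
-- from the identity.

open import Defs
open import Data.Nat using (ℕ; suc; _≤_; _+_; _*_; _∸_; _^_; _/_)
open import Data.Fin.Subset using (Subset; ∣_∣)
open import Data.Product using (Σ; ∃; ∃-syntax; _×_)
open import Relation.Binary.PropositionalEquality using (_≡_)

open import Algebra.Bundles using (AbelianGroup; Group)
open import Algebra.Structures using (IsGroup; IsAbelianGroup)
open import Algebra.Morphism.Structures using (IsGroupMonomorphism)
import Algebra.Morphism.GroupMonomorphism as GroupMonomorphism
open import Data.Bool using (true; false)
open import Data.Empty using (⊥-elim)
open import Data.Fin as Fin
  using (Fin; toℕ; fromℕ; inject₁; punchIn; combine; remQuot; funToFin; finToFun)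
open import Data.Fin.Properties
  using (toℕ-injective; toℕ<n; toℕ-fromℕ<; toℕ-fromℕ; toℕ-inject₁; ≤fromℕ; punchInᵢ≢i; all?; _≟_;
         remQuot-combine; combine-remQuot; finToFun-funToFin; funToFin-finToFin)
open import Data.Fin.Relation.Unary.Top using (view; ‵fromℕ; ‵inject₁)
open import Data.Fin.Subset using (_∈_; _∉_; ⁅_⁆; _∪_; ⊥)
open import Data.Fin.Subset.Properties using (x∈⁅x⁆; x∈⁅y⁆⇒x≡y; x∈p∪q⁻; x∈p∪q⁺; ∣⁅x⁆∣≡1; ∉⊥; ∣⊥∣≡0)
open import Data.Nat as ℕ using (zero; z≤n; s≤s; _<_; _%_; _<?_; _≤?_)
open import Data.Nat.DivMod using (_mod_; m%n<n; %-distribˡ-+; m%n%n≡m%n; n%n≡0; m<n⇒m%n≡m; m/n*n≤m)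
open import Data.Nat.Properties hiding (_≟_)
open import Data.Nat.Solver using (module +-*-Solver)
open import Algebra.Properties.CommutativeMonoid.Sum +-0-commutativeMonoid
  using (sum; sum-remove; sum-cong-≗; sum-replicate-zero)
open import Algebra.Properties.CommutativeSemigroup +-commutativeSemigroup using (xy∙z≈xz∙y; xy∙z≈zy∙x)
open import Data.Product using (_,_; proj₁; proj₂)
open import Data.Sum using (_⊎_; inj₁; inj₂)
open import Data.Vec using (_∷_; [])
open import Data.Vec.Functional using (removeAt)
open import Function using (_∘_)
open import Function.Bundles using (_⇔_; mk⇔; Equivalence)
import Function.Properties.Equivalence as ⇔
open import Relation.Binary.Structures using (IsEquivalence)
open import Relation.Binary.PropositionalEquality
  using (_≢_; _≗_; refl; sym; trans; cong; cong₂; subst; subst₂; isEquivalence; module ≡-Reasoning)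
open import Relation.Nullary using (¬_; Dec; yes; no)
open import Relation.Nullary.Decidable using (map′; _×-dec_; _→-dec_; _⊎-dec_; ¬?)

open Equivalence using (to; from)

∣p∪q∣≤∣p∣+∣q∣ : ∀ {n} (p q : Subset n) → ∣ p ∪ q ∣ ≤ ∣ p ∣ + ∣ q ∣
∣p∪q∣≤∣p∣+∣q∣ []          []          = z≤n
∣p∪q∣≤∣p∣+∣q∣ (true ∷ p)  (true ∷ q)  = s≤s (≤-trans (∣p∪q∣≤∣p∣+∣q∣ p q) (+-monoʳ-≤ ∣ p ∣ (n≤1+n ∣ q ∣)))
∣p∪q∣≤∣p∣+∣q∣ (true ∷ p)  (false ∷ q) = s≤s (∣p∪q∣≤∣p∣+∣q∣ p q)
∣p∪q∣≤∣p∣+∣q∣ (false ∷ p) (true ∷ q)  = subst (suc ∣ p ∪ q ∣ ≤_) (sym (+-suc ∣ p ∣ ∣ q ∣)) (s≤s (∣p∪q∣≤∣p∣+∣q∣ p q))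
∣p∪q∣≤∣p∣+∣q∣ (false ∷ p) (false ∷ q) = ∣p∪q∣≤∣p∣+∣q∣ p q

module _ {n : ℕ} where

  image : ∀ {r} → (Fin r → Fin n) → Subset n
  image {zero}  f = ⊥
  image {suc r} f = ⁅ f Fin.zero ⁆ ∪ image (f ∘ Fin.suc)

  ∣image∣≤ : ∀ {r} (f : Fin r → Fin n) → ∣ image f ∣ ≤ r
  ∣image∣≤ {zero}  f = ≤-reflexive (∣⊥∣≡0 n)
  ∣image∣≤ {suc r} f = begin
    ∣ ⁅ f Fin.zero ⁆ ∪ image (f ∘ Fin.suc) ∣     ≤⟨ ∣p∪q∣≤∣p∣+∣q∣ ⁅ f Fin.zero ⁆ _ ⟩
    ∣ ⁅ f Fin.zero ⁆ ∣ + ∣ image (f ∘ Fin.suc) ∣ ≡⟨ cong (_+ ∣ image (f ∘ Fin.suc) ∣) (∣⁅x⁆∣≡1 (f Fin.zero)) ⟩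
    suc ∣ image (f ∘ Fin.suc) ∣                  ≤⟨ s≤s (∣image∣≤ (f ∘ Fin.suc)) ⟩
    suc r                                        ∎
    where open ≤-Reasoning

  ∈-image : ∀ {r} (f : Fin r → Fin n) i → f i ∈ image f
  ∈-image f Fin.zero    = x∈p∪q⁺ (inj₁ (x∈⁅x⁆ (f Fin.zero)))
  ∈-image f (Fin.suc i) = x∈p∪q⁺ {p = ⁅ f Fin.zero ⁆} (inj₂ (∈-image (f ∘ Fin.suc) i))

  ∈-image⁻ : ∀ {r} (f : Fin r → Fin n) {x} → x ∈ image f → ∃[ i ] x ≡ f i
  ∈-image⁻ {zero}  f x∈ = ⊥-elim (∉⊥ x∈)
  ∈-image⁻ {suc r} f x∈ with x∈p∪q⁻ ⁅ f Fin.zero ⁆ (image (f ∘ Fin.suc)) x∈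
  ... | inj₁ x∈⁅f0⁆ = Fin.zero , x∈⁅y⁆⇒x≡y (f Fin.zero) x∈⁅f0⁆
  ... | inj₂ x∈rest with ∈-image⁻ (f ∘ Fin.suc) x∈rest
  ...   | i , x≡fi = Fin.suc i , x≡fi

m≢n⇒m<n⇔m<1+n : ∀ {m n} → m ≢ n → m < n ⇔ m < suc n
m≢n⇒m<n⇔m<1+n m≢n = mk⇔ m<n⇒m<1+n (λ m<1+n → ≤∧≢⇒< (m<1+n⇒m≤n m<1+n) m≢n)

m≢n⇒n≤m⇔n<m : ∀ {m n} → m ≢ n → n ≤ m ⇔ n < m
m≢n⇒n≤m⇔n<m m≢n = mk⇔ (λ n≤m → ≤∧≢⇒< n≤m (m≢n ∘ sym)) <⇒≤

toℕ<toℕ-fromℕ : ∀ {n} {i : Fin (suc n)} → i ≢ fromℕ n → toℕ i < toℕ (fromℕ n)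
toℕ<toℕ-fromℕ {i = i} i≢top = ≤∧≢⇒< (≤fromℕ i) (i≢top ∘ toℕ-injective)

sum-const-1 : ∀ k → sum {k} (λ _ → 1) ≡ k
sum-const-1 zero    = refl
sum-const-1 (suc k) = cong suc (sum-const-1 k)

_⇔?_ : ∀ {A B : Set} → Dec A → Dec B → Dec (A ⇔ B)
A? ⇔? B? = map′ (λ (f , g) → mk⇔ f g) (λ A⇔B → to A⇔B , from A⇔B) ((A? →-dec B?) ×-dec (B? →-dec A?))

-- The cyclic group ℤ/(n+1), indexed by n so that its carrier Fin (suc n) is never empty.
module Cyclic (n : ℕ) where

  open ≡-Reasoning

  N : ℕ
  N = suc n

  infixl 6 _⊕_
  infix 8 ⊖_

  _⊕_ : Fin N → Fin N → Fin N
  i ⊕ j = (toℕ i + toℕ j) mod N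

  ⊖_ : Fin N → Fin N
  ⊖ i = (N ∸ toℕ i) mod N

  𝟘 𝟙 : Fin N
  𝟘 = Fin.zero
  𝟙 = 1 mod N

  toℕ-mod : ∀ a → toℕ (a mod N) ≡ a % N
  toℕ-mod a = toℕ-fromℕ< (m%n<n a N)

  mod-cong : ∀ a b → a % N ≡ b % N → a mod N ≡ b mod N
  mod-cong a b eq = toℕ-injective (trans (toℕ-mod a) (trans eq (sym (toℕ-mod b))))

  mod-toℕ : ∀ i → toℕ i mod N ≡ i
  mod-toℕ i = toℕ-injective (trans (toℕ-mod (toℕ i)) (m<n⇒m%n≡m (toℕ<n i)))

  [a%N+b]%N≡[a+b]%N : ∀ a b → (a % N + b) % N ≡ (a + b) % N
  [a%N+b]%N≡[a+b]%N a b = begin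
    (a % N + b) % N         ≡⟨ %-distribˡ-+ (a % N) b N ⟩
    (a % N % N + b % N) % N ≡⟨ cong (λ t → (t + b % N) % N) (m%n%n≡m%n a N) ⟩
    (a % N + b % N) % N     ≡⟨ %-distribˡ-+ a b N ⟨
    (a + b) % N             ∎

  [a+b%N]%N≡[a+b]%N : ∀ a b → (a + b % N) % N ≡ (a + b) % N
  [a+b%N]%N≡[a+b]%N a b = begin
    (a + b % N) % N ≡⟨ cong (_% N) (+-comm a (b % N)) ⟩
    (b % N + a) % N ≡⟨ [a%N+b]%N≡[a+b]%N b a ⟩
    (b + a) % N     ≡⟨ cong (_% N) (+-comm b a) ⟩
    (a + b) % N     ∎

  toℕ-⊕ : ∀ i j → toℕ (i ⊕ j) ≡ (toℕ i + toℕ j) % N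
  toℕ-⊕ i j = toℕ-mod (toℕ i + toℕ j)

  ⊕-assoc : ∀ i j k → (i ⊕ j) ⊕ k ≡ i ⊕ (j ⊕ k)
  ⊕-assoc i j k = mod-cong (toℕ (i ⊕ j) + toℕ k) (toℕ i + toℕ (j ⊕ k)) (begin
    (toℕ (i ⊕ j) + toℕ k) % N          ≡⟨ cong (λ t → (t + toℕ k) % N) (toℕ-⊕ i j) ⟩
    ((toℕ i + toℕ j) % N + toℕ k) % N  ≡⟨ [a%N+b]%N≡[a+b]%N (toℕ i + toℕ j) (toℕ k) ⟩
    (toℕ i + toℕ j + toℕ k) % N        ≡⟨ cong (_% N) (+-assoc (toℕ i) (toℕ j) (toℕ k)) ⟩
    (toℕ i + (toℕ j + toℕ k)) % N      ≡⟨ [a+b%N]%N≡[a+b]%N (toℕ i) (toℕ j + toℕ k) ⟨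
    (toℕ i + (toℕ j + toℕ k) % N) % N  ≡⟨ cong (λ t → (toℕ i + t) % N) (toℕ-⊕ j k) ⟨
    (toℕ i + toℕ (j ⊕ k)) % N          ∎)

  ⊕-comm : ∀ i j → i ⊕ j ≡ j ⊕ i
  ⊕-comm i j = cong (_mod N) (+-comm (toℕ i) (toℕ j))

  ⊕-identityˡ : ∀ i → 𝟘 ⊕ i ≡ i
  ⊕-identityˡ = mod-toℕ

  ⊕-identityʳ : ∀ i → i ⊕ 𝟘 ≡ i
  ⊕-identityʳ i = trans (⊕-comm i 𝟘) (⊕-identityˡ i)

  ⊕-inverseʳ : ∀ i → i ⊕ ⊖ i ≡ 𝟘
  ⊕-inverseʳ i = toℕ-injective (begin
    toℕ (i ⊕ ⊖ i)                  ≡⟨ toℕ-⊕ i (⊖ i) ⟩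
    (toℕ i + toℕ (⊖ i)) % N        ≡⟨ cong (λ t → (toℕ i + t) % N) (toℕ-mod (N ∸ toℕ i)) ⟩
    (toℕ i + (N ∸ toℕ i) % N) % N  ≡⟨ [a+b%N]%N≡[a+b]%N (toℕ i) (N ∸ toℕ i) ⟩
    (toℕ i + (N ∸ toℕ i)) % N      ≡⟨ cong (_% N) (m+[n∸m]≡n (<⇒≤ (toℕ<n i))) ⟩
    N % N                          ≡⟨ n%n≡0 N ⟩
    0                              ∎)

  ⊕-inverseˡ : ∀ i → ⊖ i ⊕ i ≡ 𝟘
  ⊕-inverseˡ i = trans (⊕-comm (⊖ i) i) (⊕-inverseʳ i)

  ⊕-isAbelianGroup : IsAbelianGroup _≡_ _⊕_ 𝟘 ⊖_
  ⊕-isAbelianGroup = record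
    { isGroup = record
      { isMonoid = record
        { isSemigroup = record
          { isMagma = record { isEquivalence = isEquivalence ; ∙-cong = cong₂ _⊕_ }
          ; assoc = ⊕-assoc
          }
        ; identity = ⊕-identityˡ , ⊕-identityʳ
        }
      ; inverse = ⊕-inverseˡ , ⊕-inverseʳ
      ; ⁻¹-cong = cong ⊖_
      }
    ; comm = ⊕-comm
    }

  ⊕-abelianGroup : AbelianGroup _ _
  ⊕-abelianGroup = record { isAbelianGroup = ⊕-isAbelianGroup }

  open import Algebra.Properties.AbelianGroup ⊕-abelianGroup public
    using (⁻¹-∙-comm; ⁻¹-involutive; ε⁻¹≈ε; x∙y⁻¹≈ε⇒x≈y; ⁻¹-injective)

  ⊕-⊖-cancelʳ : ∀ i j → i ⊕ j ⊕ ⊖ j ≡ i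
  ⊕-⊖-cancelʳ i j = begin
    i ⊕ j ⊕ ⊖ j   ≡⟨ ⊕-assoc i j (⊖ j) ⟩
    i ⊕ (j ⊕ ⊖ j) ≡⟨ cong (i ⊕_) (⊕-inverseʳ j) ⟩
    i ⊕ 𝟘         ≡⟨ ⊕-identityʳ i ⟩
    i             ∎

  ⊖-⊕-cancelʳ : ∀ i j → i ⊕ ⊖ j ⊕ j ≡ i
  ⊖-⊕-cancelʳ i j = begin
    i ⊕ ⊖ j ⊕ j     ≡⟨ cong (λ t → i ⊕ ⊖ j ⊕ t) (⁻¹-involutive j) ⟨
    i ⊕ ⊖ j ⊕ ⊖ ⊖ j ≡⟨ ⊕-⊖-cancelʳ i (⊖ j) ⟩
    i               ∎

  toℕ-mod-< : ∀ {a} → a < N → toℕ (a mod N) ≡ a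
  toℕ-mod-< {a} a<N = trans (toℕ-mod a) (m<n⇒m%n≡m a<N)

  mod-⊕𝟙 : ∀ a → a mod N ⊕ 𝟙 ≡ suc a mod N
  mod-⊕𝟙 a = mod-cong (toℕ (a mod N) + toℕ 𝟙) (suc a) (begin
    (toℕ (a mod N) + toℕ 𝟙) % N  ≡⟨ cong₂ (λ s t → (s + t) % N) (toℕ-mod a) (toℕ-mod 1) ⟩
    (a % N + 1 % N) % N          ≡⟨ %-distribˡ-+ a 1 N ⟨
    (a + 1) % N                  ≡⟨ cong (_% N) (+-comm a 1) ⟩
    suc a % N                    ∎)

  ⊖≢𝟘 : ∀ {i} → i ≢ 𝟘 → ⊖ i ≢ 𝟘
  ⊖≢𝟘 i≢𝟘 ⊖i≡𝟘 = i≢𝟘 (⁻¹-injective (trans ⊖i≡𝟘 (sym ε⁻¹≈ε)))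

  toℕ-⊕𝟙 : ∀ i → toℕ (i ⊕ 𝟙) ≡ suc (toℕ i) % N
  toℕ-⊕𝟙 i = begin
    toℕ (i ⊕ 𝟙)          ≡⟨ toℕ-⊕ i 𝟙 ⟩
    (toℕ i + toℕ 𝟙) % N  ≡⟨ cong (λ t → (toℕ i + t) % N) (toℕ-mod 1) ⟩
    (toℕ i + 1 % N) % N  ≡⟨ [a+b%N]%N≡[a+b]%N (toℕ i) 1 ⟩
    (toℕ i + 1) % N      ≡⟨ cong (_% N) (+-comm (toℕ i) 1) ⟩
    suc (toℕ i) % N      ∎

  inject₁-⊕𝟙 : ∀ i → inject₁ i ⊕ 𝟙 ≡ Fin.suc i
  inject₁-⊕𝟙 i = toℕ-injective (begin
    toℕ (inject₁ i ⊕ 𝟙)        ≡⟨ toℕ-⊕𝟙 (inject₁ i) ⟩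
    suc (toℕ (inject₁ i)) % N  ≡⟨ cong (λ t → suc t % N) (toℕ-inject₁ i) ⟩
    suc (toℕ i) % N            ≡⟨ m<n⇒m%n≡m (s≤s (toℕ<n i)) ⟩
    suc (toℕ i)                ∎)

  fromℕ-⊕𝟙 : fromℕ n ⊕ 𝟙 ≡ 𝟘
  fromℕ-⊕𝟙 = toℕ-injective (begin
    toℕ (fromℕ n ⊕ 𝟙)        ≡⟨ toℕ-⊕𝟙 (fromℕ n) ⟩
    suc (toℕ (fromℕ n)) % N  ≡⟨ cong (λ t → suc t % N) (toℕ-fromℕ n) ⟩
    N % N                    ≡⟨ n%n≡0 N ⟩
    0                        ∎)

module EncodedGroup
  {A : Set} {_≈_ : A → A → Set} {_∙_ : A → A → A} {ε : A} {_⁻¹ : A → A}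
  (isGroup : IsGroup _≈_ _∙_ ε _⁻¹)
  {n : ℕ} (encode : A → Fin n) (decode : Fin n → A)
  (encode-cong : ∀ {a b} → a ≈ b → encode a ≡ encode b)
  (decode-encode : ∀ a → decode (encode a) ≈ a)
  (encode-decode : ∀ i → encode (decode i) ≡ i)
  where

  private module A = IsGroup isGroup

  infixl 7 _·_

  _·_ : Fin n → Fin n → Fin n
  i · j = encode (decode i ∙ decode j)

  inv : Fin n → Fin n
  inv i = encode (decode i ⁻¹)

  decode-isGroupMonomorphism :
    IsGroupMonomorphism (record { _≈_ = _≡_ ; _∙_ = _·_ ; ε = encode ε ; _⁻¹ = inv })
                        (record { _≈_ = _≈_ ; _∙_ = _∙_ ; ε = ε ; _⁻¹ = _⁻¹ }) decode
  decode-isGroupMonomorphism = record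
    { isGroupHomomorphism = record
      { isMonoidHomomorphism = record
        { isMagmaHomomorphism = record
          { isRelHomomorphism = record { cong = λ { refl → A.refl } }
          ; homo = λ i j → decode-encode (decode i ∙ decode j)
          }
        ; ε-homo = decode-encode ε
        }
      ; ⁻¹-homo = λ i → decode-encode (decode i ⁻¹)
      }
    ; injective = λ {i} {j} di≈dj → trans (sym (encode-decode i)) (trans (encode-cong di≈dj) (encode-decode j))
    }

  finiteGroup : FiniteGroup n
  finiteGroup = record
    { _·_ = _·_ ; e = encode ε ; inv = inv
    ; isGroup = GroupMonomorphism.isGroup decode-isGroupMonomorphism isGroup
    }

  encode-∙ : ∀ a b → encode a · encode b ≡ encode (a ∙ b)
  encode-∙ a b = encode-cong (A.∙-cong (decode-encode a) (decode-encode b))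

  encode-⁻¹ : ∀ a → inv (encode a) ≡ encode (a ⁻¹)
  encode-⁻¹ a = encode-cong (A.⁻¹-cong (decode-encode a))

  decode-· : ∀ i j → decode (i · j) ≈ (decode i ∙ decode j)
  decode-· i j = decode-encode (decode i ∙ decode j)

module CayleyGraph {n : ℕ} (G : FiniteGroup n) (S : Subset n) where

  open FiniteGroup G
  open IsGroup isGroup using (assoc; identityˡ; identityʳ; inverseʳ)

  extend : ∀ {j g h s} → Walk G S j g h → s ∈ S → Walk G S (suc j) g (h · s)
  extend (here g)         s∈S = step _ s∈S (here (g · _))
  extend (step s' s'∈S w) s∈S = step s' s'∈S (extend w s∈S)

  translate : ∀ a {j g h} → Walk G S j g h → Walk G S j (a · g) (a · h)
  translate a (here g) = here (a · g)
  translate a {suc j} {g} {h} (step s s∈S w) =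
    step s s∈S (subst (λ x → Walk G S j x (a · h)) (sym (assoc a g s)) (translate a w))

  Dist≤-translate : ∀ k → (∀ h → Dist≤ G S k e h) → ∀ g h → Dist≤ G S k g h
  Dist≤-translate k from-e g h with from-e (inv g · h)
  ... | j , j≤k , w = j , j≤k , subst₂ (Walk G S j) (identityʳ g) g·[g⁻¹·h]≡h (translate g w)
    where
    g·[g⁻¹·h]≡h : g · (inv g · h) ≡ h
    g·[g⁻¹·h]≡h = trans (sym (assoc g (inv g) h)) (trans (cong (_· h) (inverseʳ g)) (identityˡ h))

  potential-walk : (φ : Fin n → ℕ) → (∀ g s → s ∈ S → φ (g · s) ≤ φ g + 1) →
                   ∀ {j g h} → Walk G S j g h → φ h ≤ φ g + j
  potential-walk φ φ-step (here g) = m≤m+n (φ g) 0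
  potential-walk φ φ-step {suc j} {g} {h} (step s s∈S w) = begin
    φ h               ≤⟨ potential-walk φ φ-step w ⟩
    φ (g · s) + j     ≤⟨ +-monoˡ-≤ j (φ-step g s s∈S) ⟩
    φ g + 1 + j       ≡⟨ +-assoc (φ g) 1 j ⟩
    φ g + suc j       ∎
    where open ≤-Reasoning

module Lamplighter (n c : ℕ) where

  module P = Cyclic n
  module C = Cyclic c
  open P using (_⊕_; ⊖_; 𝟘; 𝟙)

  Position : Set
  Position = Fin (suc n)

  Colour : Set
  Colour = Fin (suc c)

  Config : Set
  Config = Position → Colour

  -- An element of ℤ/(c+1) ≀ ℤ/(n+1): the colours of the n+1 lamps on a cycle, and the
  -- lamplighter's position, by which the second factor of a product is shifted.
  Lamp : Set
  Lamp = Config × Position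

  infix 4 _≈_
  infixl 7 _⊗_

  _≈_ : Lamp → Lamp → Set
  (x , p) ≈ (y , q) = x ≗ y × p ≡ q

  _⊗_ : Lamp → Lamp → Lamp
  (x , p) ⊗ (y , q) = (λ i → x i C.⊕ y (i ⊕ ⊖ p)) , p ⊕ q

  unit : Lamp
  unit = (λ _ → C.𝟘) , 𝟘

  _⁻¹ : Lamp → Lamp
  (x , p) ⁻¹ = (λ i → C.⊖ x (i ⊕ p)) , ⊖ p

  ≈-isEquivalence : IsEquivalence _≈_
  ≈-isEquivalence = record
    { refl  = (λ _ → refl) , refl
    ; sym   = λ (x≗y , p≡q) → (sym ∘ x≗y) , sym p≡q
    ; trans = λ (x≗y , p≡q) (y≗z , q≡r) → (λ i → trans (x≗y i) (y≗z i)) , trans p≡q q≡r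
    }

  ⊗-cong : ∀ {a a' b b'} → a ≈ a' → b ≈ b' → a ⊗ b ≈ a' ⊗ b'
  ⊗-cong {_ , p} (x≗x' , refl) (y≗y' , refl) = (λ i → cong₂ C._⊕_ (x≗x' i) (y≗y' (i ⊕ ⊖ p))) , refl

  ⁻¹-cong : ∀ {a a'} → a ≈ a' → a ⁻¹ ≈ a' ⁻¹
  ⁻¹-cong {_ , p} (x≗x' , refl) = (λ i → cong C.⊖_ (x≗x' (i ⊕ p))) , refl

  ⊗-assoc : ∀ a b d → (a ⊗ b) ⊗ d ≈ a ⊗ (b ⊗ d)
  ⊗-assoc (x , p) (y , q) (z , r) = colours , P.⊕-assoc p q r
    where
    shift : ∀ i → i ⊕ ⊖ (p ⊕ q) ≡ i ⊕ ⊖ p ⊕ ⊖ q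
    shift i = trans (cong (i ⊕_) (sym (P.⁻¹-∙-comm p q))) (sym (P.⊕-assoc i (⊖ p) (⊖ q)))
    colours : ∀ i → x i C.⊕ y (i ⊕ ⊖ p) C.⊕ z (i ⊕ ⊖ (p ⊕ q)) ≡ x i C.⊕ (y (i ⊕ ⊖ p) C.⊕ z (i ⊕ ⊖ p ⊕ ⊖ q))
    colours i = trans (C.⊕-assoc (x i) (y (i ⊕ ⊖ p)) _) (cong (λ t → x i C.⊕ (y (i ⊕ ⊖ p) C.⊕ z t)) (shift i))

  ⊗-identityˡ : ∀ a → unit ⊗ a ≈ a
  ⊗-identityˡ (y , q) = colours , P.⊕-identityˡ q
    where
    colours : ∀ i → C.𝟘 C.⊕ y (i ⊕ ⊖ 𝟘) ≡ y i
    colours i = trans (C.⊕-identityˡ _) (cong y (trans (cong (i ⊕_) P.ε⁻¹≈ε) (P.⊕-identityʳ i)))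

  ⊗-identityʳ : ∀ a → a ⊗ unit ≈ a
  ⊗-identityʳ (x , p) = (λ i → C.⊕-identityʳ (x i)) , P.⊕-identityʳ p

  ⊗-inverseˡ : ∀ a → a ⁻¹ ⊗ a ≈ unit
  ⊗-inverseˡ (x , p) = colours , P.⊕-inverseˡ p
    where
    colours : ∀ i → C.⊖ x (i ⊕ p) C.⊕ x (i ⊕ ⊖ ⊖ p) ≡ C.𝟘
    colours i = trans (cong (λ t → C.⊖ x (i ⊕ p) C.⊕ x (i ⊕ t)) (P.⁻¹-involutive p)) (C.⊕-inverseˡ (x (i ⊕ p)))

  ⊗-inverseʳ : ∀ a → a ⊗ a ⁻¹ ≈ unit
  ⊗-inverseʳ (x , p) = colours , P.⊕-inverseʳ p
    where
    colours : ∀ i → x i C.⊕ C.⊖ x (i ⊕ ⊖ p ⊕ p) ≡ C.𝟘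
    colours i = trans (cong (λ t → x i C.⊕ C.⊖ x t) (P.⊖-⊕-cancelʳ i p)) (C.⊕-inverseʳ (x i))

  ⊗-isGroup : IsGroup _≈_ _⊗_ unit _⁻¹
  ⊗-isGroup = record
    { isMonoid = record
      { isSemigroup = record
        { isMagma = record { isEquivalence = ≈-isEquivalence ; ∙-cong = ⊗-cong }
        ; assoc = ⊗-assoc
        }
      ; identity = ⊗-identityˡ , ⊗-identityʳ
      }
    ; inverse = ⊗-inverseˡ , ⊗-inverseʳ
    ; ⁻¹-cong = ⁻¹-cong
    }

  ⊗-group : Group _ _
  ⊗-group = record { isGroup = ⊗-isGroup }

  open import Algebra.Properties.Group ⊗-group public using (⁻¹-involutive)

  order : ℕ
  order = suc n * suc c ^ suc n

  -- Abstract, so that unification never unfolds the mixed-radix arithmetic of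
  -- combine and remQuot on the large modulus (which exhausts memory).
  abstract
    funToFin-cong : ∀ {k} {x y : Fin k → Colour} → x ≗ y → funToFin x ≡ funToFin y
    funToFin-cong {zero}  x≗y = refl
    funToFin-cong {suc k} x≗y = cong₂ combine (x≗y Fin.zero) (funToFin-cong (x≗y ∘ Fin.suc))

    encode : Lamp → Fin order
    encode (x , p) = combine p (funToFin x)

    decode : Fin order → Lamp
    decode i = finToFun (proj₂ (remQuot {suc n} (suc c ^ suc n) i)) , proj₁ (remQuot {suc n} (suc c ^ suc n) i)

    encode-cong : ∀ {a b} → a ≈ b → encode a ≡ encode b
    encode-cong {_ , p} (x≗y , refl) = cong (combine p) (funToFin-cong x≗y)

    decode-encode : ∀ a → decode (encode a) ≈ a
    decode-encode (x , p) =
      (λ i → trans (cong (λ pr → finToFun (proj₂ pr) i) split) (finToFun-funToFin x i)) , cong proj₁ split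
      where
      split : remQuot {suc n} (suc c ^ suc n) (combine p (funToFin x)) ≡ (p , funToFin x)
      split = remQuot-combine p (funToFin x)

    encode-decode : ∀ i → encode (decode i) ≡ i
    encode-decode i = trans (cong (combine (proj₁ (remQuot {suc n} (suc c ^ suc n) i))) (funToFin-finToFin {suc n} {suc c} _))
                            (combine-remQuot {suc n} (suc c ^ suc n) i)

  open EncodedGroup ⊗-isGroup encode decode encode-cong decode-encode encode-decode public

  open IsEquivalence ≈-isEquivalence public using () renaming (refl to ≈-refl; sym to ≈-sym; trans to ≈-trans)

  atOrigin : Colour → Config
  atOrigin a Fin.zero    = a
  atOrigin a (Fin.suc _) = C.𝟘

  move : Colour → Lamp
  move a = atOrigin a , 𝟙

  turn : Position → Lamp
  turn q = (λ _ → C.𝟘) , q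

  paint : Colour → Lamp
  paint a = atOrigin a , 𝟘

  ⊗-atOrigin-here : ∀ x p a q → proj₁ ((x , p) ⊗ (atOrigin a , q)) p ≡ x p C.⊕ a
  ⊗-atOrigin-here x p a q = cong (λ i → x p C.⊕ atOrigin a i) (P.⊕-inverseʳ p)

  ⊗-atOrigin-elsewhere : ∀ x p a q i → i ≢ p → proj₁ ((x , p) ⊗ (atOrigin a , q)) i ≡ x i
  ⊗-atOrigin-elsewhere x p a q i i≢p with i ⊕ ⊖ p in eq
  ... | Fin.zero  = ⊥-elim (i≢p (P.x∙y⁻¹≈ε⇒x≈y i p eq))
  ... | Fin.suc _ = C.⊕-identityʳ (x i)

  ⊗-turn : ∀ x p q → (x , p) ⊗ turn q ≈ (x , p ⊕ q)
  ⊗-turn x p q = (λ i → C.⊕-identityʳ (x i)) , refl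

  turn⁻¹ : ∀ q → turn q ⁻¹ ≈ turn (⊖ q)
  turn⁻¹ q = (λ _ → C.ε⁻¹≈ε) , refl

  move⁻¹ : ∀ a → move a ⁻¹ ≈ turn (⊖ 𝟙) ⊗ paint (C.⊖ a)
  move⁻¹ a = colours , sym (P.⊕-identityʳ (⊖ 𝟙))
    where
    ⊖-atOrigin : ∀ i → C.⊖ atOrigin a i ≡ atOrigin (C.⊖ a) i
    ⊖-atOrigin Fin.zero    = refl
    ⊖-atOrigin (Fin.suc _) = C.ε⁻¹≈ε
    colours : ∀ i → C.⊖ atOrigin a (i ⊕ 𝟙) ≡ C.𝟘 C.⊕ atOrigin (C.⊖ a) (i ⊕ ⊖ ⊖ 𝟙)
    colours i = begin
      C.⊖ atOrigin a (i ⊕ 𝟙)                 ≡⟨ ⊖-atOrigin (i ⊕ 𝟙) ⟩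
      atOrigin (C.⊖ a) (i ⊕ 𝟙)               ≡⟨ cong (λ t → atOrigin (C.⊖ a) (i ⊕ t)) (P.⁻¹-involutive 𝟙) ⟨
      atOrigin (C.⊖ a) (i ⊕ ⊖ ⊖ 𝟙)           ≡⟨ C.⊕-identityˡ _ ⟨
      C.𝟘 C.⊕ atOrigin (C.⊖ a) (i ⊕ ⊖ ⊖ 𝟙)  ∎
      where open ≡-Reasoning

  ⊗-move⁻¹ : ∀ x p a → (x , p) ⊗ move a ⁻¹ ≈ (x , p ⊕ ⊖ 𝟙) ⊗ paint (C.⊖ a)
  ⊗-move⁻¹ x p a =
    ≈-trans (⊗-cong {a = x , p} ≈-refl (move⁻¹ a))
   (≈-trans (≈-sym (⊗-assoc (x , p) (turn (⊖ 𝟙)) (paint (C.⊖ a))))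
            (⊗-cong {b = paint (C.⊖ a)} (⊗-turn x p (⊖ 𝟙)) ≈-refl))

  Lit : Colour → Set
  Lit a = a ≢ C.𝟘

  Lit-≡ : ∀ {a b} → a ≡ b → Lit a ⇔ Lit b
  Lit-≡ refl = ⇔.refl

  lit : Colour → ℕ
  lit Fin.zero    = 0
  lit (Fin.suc _) = 1

  litCount : Config → ℕ
  litCount x = sum (lit ∘ x)

  litCount-update : ∀ {x x' q} → (∀ i → i ≢ q → x' i ≡ x i) →
                    litCount x' + lit (x q) ≡ litCount x + lit (x' q)
  litCount-update {x} {x'} {q} agree = begin
    litCount x' + lit (x q)                                ≡⟨ cong (_+ lit (x q)) (sum-remove {i = q} (lit ∘ x')) ⟩
    lit (x' q) + sum (removeAt (lit ∘ x') q) + lit (x q)   ≡⟨ cong (λ t → lit (x' q) + t + lit (x q)) rest ⟩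
    lit (x' q) + sum (removeAt (lit ∘ x) q) + lit (x q)    ≡⟨ xy∙z≈zy∙x (lit (x' q)) _ (lit (x q)) ⟩
    lit (x q) + sum (removeAt (lit ∘ x) q) + lit (x' q)    ≡⟨ cong (_+ lit (x' q)) (sum-remove {i = q} (lit ∘ x)) ⟨
    litCount x + lit (x' q)                                ∎
    where
    open ≡-Reasoning
    rest : sum (removeAt (lit ∘ x') q) ≡ sum (removeAt (lit ∘ x) q)
    rest = sum-cong-≗ (λ j → cong lit (agree (punchIn q j) (punchInᵢ≢i q j)))

  LitBelow : Config → Position → Set
  LitBelow x p = ∀ i → Lit (x i) ⇔ toℕ i < toℕ p

  LitFrom : Config → Position → Set
  LitFrom x p = ∀ i → Lit (x i) ⇔ toℕ p ≤ toℕ i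

  Aligned : Config → Position → Set
  Aligned x p = LitBelow x p ⊎ LitFrom x p

  aligned? : ∀ x p → Dec (Aligned x p)
  aligned? x p = all? (λ i → Lit? i ⇔? (toℕ i <? toℕ p)) ⊎-dec all? (λ i → Lit? i ⇔? (toℕ p ≤? toℕ i))
    where
    Lit? : ∀ i → Dec (Lit (x i))
    Lit? i = ¬? (x i ≟ C.𝟘)

  Aligned-cong : ∀ {x y p} → x ≗ y → Aligned x p → Aligned y p
  Aligned-cong x≗y (inj₁ below) = inj₁ λ i → ⇔.trans (Lit-≡ (sym (x≗y i))) (below i)
  Aligned-cong x≗y (inj₂ above) = inj₂ λ i → ⇔.trans (Lit-≡ (sym (x≗y i))) (above i)

  misaligned : Config → Position → ℕ
  misaligned x p with aligned? x p
  ... | yes _ = 0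
  ... | no _  = 1

  misaligned≤1 : ∀ x p → misaligned x p ≤ 1
  misaligned≤1 x p with aligned? x p
  ... | yes _ = z≤n
  ... | no _  = s≤s z≤n

  aligned⇒misaligned≡0 : ∀ {x p} → Aligned x p → misaligned x p ≡ 0
  aligned⇒misaligned≡0 {x} {p} al with aligned? x p
  ... | yes _  = refl
  ... | no ¬al = ⊥-elim (¬al al)

  ¬aligned⇒misaligned≡1 : ∀ {x p} → ¬ Aligned x p → misaligned x p ≡ 1
  ¬aligned⇒misaligned≡1 {x} {p} ¬al with aligned? x p
  ... | yes al = ⊥-elim (¬al al)
  ... | no _   = refl

  misaligned-mono : ∀ {x x' p p'} → (Aligned x p → Aligned x' p') → misaligned x' p' ≤ misaligned x p
  misaligned-mono {x} {x'} {p} {p'} realign with aligned? x p | aligned? x' p'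
  ... | _        | yes _    = z≤n
  ... | no _     | no _     = ≤-refl
  ... | yes al   | no ¬al'  = ⊥-elim (¬al' (realign al))

  potential : Lamp → ℕ
  potential (x , p) = litCount x + misaligned x p

  potential-cong : ∀ {a b} → a ≈ b → potential a ≡ potential b
  potential-cong {x , p} {y , .p} (x≗y , refl) =
    cong₂ _+_ (sum-cong-≗ (cong lit ∘ x≗y))
              (≤-antisym (misaligned-mono (Aligned-cong (sym ∘ x≗y))) (misaligned-mono (Aligned-cong x≗y)))

  lit≤1 : ∀ a → lit a ≤ 1
  lit≤1 Fin.zero    = z≤n
  lit≤1 (Fin.suc _) = ≤-refl

  litCount≤⇒potential≤ : ∀ {x x' p p'} → litCount x' ≤ litCount x → potential (x' , p') ≤ potential (x , p) + 1
  litCount≤⇒potential≤ {x} {x'} {p} {p'} le = begin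
    litCount x' + misaligned x' p'   ≤⟨ +-mono-≤ le (misaligned≤1 x' p') ⟩
    litCount x + 1                   ≤⟨ +-monoˡ-≤ 1 (m≤m+n (litCount x) (misaligned x p)) ⟩
    litCount x + misaligned x p + 1  ∎
    where open ≤-Reasoning

  potential-update : ∀ {x x' q p p'} → (∀ i → i ≢ q → x' i ≡ x i) →
                     (x q ≡ C.𝟘 → Lit (x' q) → Aligned x p → Aligned x' p') →
                     potential (x' , p') ≤ potential (x , p) + 1
  potential-update {x} {x'} {q} {p} {p'} agree realign
    with x q | x' q | litCount-update {x} {x'} {q} agree
  ... | Fin.suc _ | a' | count = litCount≤⇒potential≤ {x} {x'} {p} {p'} (+-cancelʳ-≤ 1 (litCount x') (litCount x)
                                   (subst (_≤ litCount x + 1) (sym count) (+-monoʳ-≤ (litCount x) (lit≤1 a'))))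
  ... | Fin.zero | Fin.zero | count =
    litCount≤⇒potential≤ {x} {x'} {p} {p'} (≤-reflexive (+-cancelʳ-≡ 0 (litCount x') (litCount x) count))
  ... | Fin.zero | Fin.suc _ | count = begin
    litCount x' + misaligned x' p'     ≤⟨ +-monoʳ-≤ (litCount x') (misaligned-mono (realign refl λ ())) ⟩
    litCount x' + misaligned x p       ≡⟨ cong (_+ misaligned x p) (trans (sym (+-identityʳ (litCount x'))) count) ⟩
    litCount x + 1 + misaligned x p    ≡⟨ xy∙z≈xz∙y (litCount x) 1 (misaligned x p) ⟩
    litCount x + misaligned x p + 1    ∎
    where open ≤-Reasoning

  aligned-forward : ∀ {x x' p} → (∀ i → i ≢ p → x' i ≡ x i) → x p ≡ C.𝟘 → Lit (x' p) →
                    Aligned x p → Aligned x' (p ⊕ 𝟙)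
  aligned-forward {p = p} agree xp≡0 lit' (inj₂ above) = ⊥-elim (from (above p) ≤-refl xp≡0)
  aligned-forward {x} {x'} {p} agree xp≡0 lit' (inj₁ below) with view p
  ... | ‵inject₁ j = inj₁ (subst (LitBelow x') (sym (P.inject₁-⊕𝟙 j)) below')
    where
    below' : LitBelow x' (Fin.suc j)
    below' i with i ≟ inject₁ j
    ... | yes refl = mk⇔ (λ _ → s≤s (≤-reflexive (toℕ-inject₁ j))) (λ _ → lit')
    ... | no i≢p = subst (λ t → Lit (x' i) ⇔ toℕ i < suc t) (toℕ-inject₁ j)
                     (⇔.trans (Lit-≡ (agree i i≢p)) (⇔.trans (below i) (m≢n⇒m<n⇔m<1+n (i≢p ∘ toℕ-injective))))
  ... | ‵fromℕ = inj₂ (subst (LitFrom x') (sym P.fromℕ-⊕𝟙) (λ i → mk⇔ (λ _ → z≤n) (λ _ → allLit i)))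
    where
    allLit : ∀ i → Lit (x' i)
    allLit i with i ≟ fromℕ n
    ... | yes refl = lit'
    ... | no i≢p = from (Lit-≡ (agree i i≢p)) (from (below i) (toℕ<toℕ-fromℕ i≢p))

  aligned-backward : ∀ {x x' q} → (∀ i → i ≢ q → x' i ≡ x i) → x q ≡ C.𝟘 → Lit (x' q) →
                     Aligned x (q ⊕ 𝟙) → Aligned x' q
  aligned-backward {x} {x'} {q} agree xq≡0 lit' aligned with view q
  ... | ‵fromℕ with subst (Aligned x) P.fromℕ-⊕𝟙 aligned
  ...   | inj₂ above = ⊥-elim (from (above (fromℕ n)) z≤n xq≡0)
  ...   | inj₁ below = inj₂ above'
    where
    above' : LitFrom x' (fromℕ n)
    above' i with i ≟ fromℕ n
    ... | yes refl = mk⇔ (λ _ → ≤-refl) (λ _ → lit')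
    ... | no i≢q = mk⇔ (λ lit-i → ⊥-elim (n≮0 (to (below i) (to (Lit-≡ (agree i i≢q)) lit-i))))
                       (λ top≤i → ⊥-elim (<⇒≱ (toℕ<toℕ-fromℕ i≢q) top≤i))
  aligned-backward {x} {x'} {q} agree xq≡0 lit' aligned | ‵inject₁ j with subst (Aligned x) (P.inject₁-⊕𝟙 j) aligned
  ...   | inj₁ below = ⊥-elim (from (below (inject₁ j)) (s≤s (≤-reflexive (toℕ-inject₁ j))) xq≡0)
  ...   | inj₂ above = inj₂ above'
    where
    above' : LitFrom x' (inject₁ j)
    above' i with i ≟ inject₁ j
    ... | yes refl = mk⇔ (λ _ → ≤-refl) (λ _ → lit')
    ... | no i≢q = ⇔.trans (Lit-≡ (agree i i≢q))
                     (⇔.trans (above i) (subst (λ t → suc t ≤ toℕ i ⇔ toℕ (inject₁ j) ≤ toℕ i) (toℕ-inject₁ j)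
                                                 (⇔.sym (m≢n⇒n≤m⇔n<m (i≢q ∘ toℕ-injective)))))

  potential-move : ∀ b a → potential (b ⊗ move a) ≤ potential b + 1
  potential-move (x , p) a = potential-update agree (aligned-forward agree)
    where
    agree : ∀ i → i ≢ p → proj₁ ((x , p) ⊗ move a) i ≡ x i
    agree = ⊗-atOrigin-elsewhere x p a 𝟙

  potential-move⁻¹ : ∀ b a → potential (b ⊗ move a ⁻¹) ≤ potential b + 1
  potential-move⁻¹ (x , p) a = begin
    potential ((x , p) ⊗ move a ⁻¹)          ≡⟨ potential-cong (⊗-move⁻¹ x p a) ⟩
    potential ((x , q) ⊗ paint (C.⊖ a))      ≤⟨ potential-update agree realign ⟩
    potential (x , p) + 1                    ∎
    where
    open ≤-Reasoning
    q = p ⊕ ⊖ 𝟙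
    agree : ∀ i → i ≢ q → proj₁ ((x , q) ⊗ paint (C.⊖ a)) i ≡ x i
    agree = ⊗-atOrigin-elsewhere x q (C.⊖ a) 𝟘
    realign : x q ≡ C.𝟘 → Lit (proj₁ ((x , q) ⊗ paint (C.⊖ a)) q) → Aligned x p →
              Aligned (proj₁ ((x , q) ⊗ paint (C.⊖ a))) (q ⊕ 𝟘)
    realign xq≡0 lit' aligned = subst (Aligned _) (sym (P.⊕-identityʳ q))
      (aligned-backward agree xq≡0 lit' (subst (Aligned x) (sym (P.⊖-⊕-cancelʳ p 𝟙)) aligned))

  potential-turn : ∀ b q → potential (b ⊗ turn q) ≤ potential b + 1
  potential-turn (x , p) q = begin
    potential ((x , p) ⊗ turn q)  ≡⟨ potential-cong (⊗-turn x p q) ⟩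
    potential (x , p ⊕ q)         ≤⟨ potential-update {x} {x} {p} {p} {p ⊕ q} (λ _ _ → refl) (λ xp≡0 lit → ⊥-elim (lit xp≡0)) ⟩
    potential (x , p) + 1         ∎
    where open ≤-Reasoning

module LamplighterCayley (n c : ℕ) where

  open Lamplighter (suc n) (suc c)
  open P using (_⊕_; ⊖_; 𝟘; 𝟙; N)

  G : FiniteGroup order
  G = finiteGroup

  data Generator : Lamp → Set where
    move⁺ : ∀ a → Generator (move (Fin.suc a))
    move⁻ : ∀ a → Generator (move (Fin.suc a) ⁻¹)
    turn⁺ : ∀ j → Generator (turn (Fin.suc j))

  forward backward : Fin (suc c) → Fin order
  forward  = encode ∘ move ∘ Fin.suc
  backward = encode ∘ _⁻¹ ∘ move ∘ Fin.suc

  rotate : Fin (suc n) → Fin order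
  rotate = encode ∘ turn ∘ Fin.suc

  S : Subset order
  S = image forward ∪ (image backward ∪ image rotate)

  open CayleyGraph G S

  ∣S∣≤ : ∣ S ∣ ≤ suc c + (suc c + suc n)
  ∣S∣≤ = begin
    ∣ S ∣                                                  ≤⟨ ∣p∪q∣≤∣p∣+∣q∣ (image forward) _ ⟩
    ∣ image forward ∣ + ∣ image backward ∪ image rotate ∣  ≤⟨ +-monoʳ-≤ ∣ image forward ∣ (∣p∪q∣≤∣p∣+∣q∣ (image backward) _) ⟩
    ∣ image forward ∣ + (∣ image backward ∣ + ∣ image rotate ∣)
      ≤⟨ +-mono-≤ (∣image∣≤ forward) (+-mono-≤ (∣image∣≤ backward) (∣image∣≤ rotate)) ⟩
    suc c + (suc c + suc n)                                ∎
    where open ≤-Reasoning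

  generator∈S : ∀ {a} → Generator a → encode a ∈ S
  generator∈S (move⁺ a) = x∈p∪q⁺ (inj₁ (∈-image forward a))
  generator∈S (move⁻ a) = x∈p∪q⁺ {p = image forward}
                            (inj₂ (x∈p∪q⁺ (inj₁ (∈-image backward a))))
  generator∈S (turn⁺ j) = x∈p∪q⁺ {p = image forward}
                            (inj₂ (x∈p∪q⁺ {p = image backward} (inj₂ (∈-image rotate j))))

  ∈S⇒generator : ∀ {s} → s ∈ S → ∃[ a ] Generator a × s ≡ encode a
  ∈S⇒generator s∈S with x∈p∪q⁻ (image forward) _ s∈S
  ... | inj₁ s∈fwd with ∈-image⁻ forward s∈fwd
  ...   | a , refl = _ , move⁺ a , refl
  ∈S⇒generator s∈S | inj₂ s∈rest with x∈p∪q⁻ (image backward) _ s∈rest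
  ... | inj₁ s∈bwd with ∈-image⁻ backward s∈bwd
  ...   | a , refl = _ , move⁻ a , refl
  ∈S⇒generator s∈S | inj₂ s∈rest | inj₂ s∈rot with ∈-image⁻ rotate s∈rot
  ...   | j , refl = _ , turn⁺ j , refl

  turn∈S : ∀ {q} → q ≢ 𝟘 → encode (turn q) ∈ S
  turn∈S {Fin.zero}  q≢𝟘 = ⊥-elim (q≢𝟘 refl)
  turn∈S {Fin.suc j} q≢𝟘 = generator∈S (turn⁺ j)

  move∈S : ∀ a → encode (move a) ∈ S
  move∈S Fin.zero    = subst (_∈ S) (encode-cong {turn 𝟙} {move Fin.zero} (atOrigin-𝟘 , refl)) (turn∈S {𝟙} λ ())
    where
    atOrigin-𝟘 : ∀ i → C.𝟘 ≡ atOrigin C.𝟘 i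
    atOrigin-𝟘 Fin.zero    = refl
    atOrigin-𝟘 (Fin.suc _) = refl
  move∈S (Fin.suc a) = generator∈S (move⁺ a)

  generator-position≢𝟘 : ∀ {a} → Generator a → proj₂ a ≢ 𝟘
  generator-position≢𝟘 (move⁺ a) ()
  generator-position≢𝟘 (move⁻ a) = P.⊖≢𝟘 {𝟙} λ ()
  generator-position≢𝟘 (turn⁺ j) ()

  generator⁻¹∈S : ∀ {a} → Generator a → encode (a ⁻¹) ∈ S
  generator⁻¹∈S (move⁺ a) = generator∈S (move⁻ a)
  generator⁻¹∈S (move⁻ a) =
    subst (_∈ S) (encode-cong (≈-sym (⁻¹-involutive (move (Fin.suc a))))) (generator∈S (move⁺ a))
  generator⁻¹∈S (turn⁺ j) =
    subst (_∈ S) (encode-cong (≈-sym (turn⁻¹ (Fin.suc j)))) (turn∈S {⊖ Fin.suc j} (P.⊖≢𝟘 {Fin.suc j} λ ()))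

  e∉S : encode unit ∉ S
  e∉S e∈S with ∈S⇒generator e∈S
  ... | a , gen , e≡a = generator-position≢𝟘 gen (begin
    proj₂ a                        ≡⟨ proj₂ (decode-encode a) ⟨
    proj₂ (decode (encode a))      ≡⟨ cong (proj₂ ∘ decode) e≡a ⟨
    proj₂ (decode (encode unit))   ≡⟨ proj₂ (decode-encode unit) ⟩
    𝟘                              ∎)
    where open ≡-Reasoning

  inv∈S : ∀ s → s ∈ S → inv s ∈ S
  inv∈S s s∈S with ∈S⇒generator s∈S
  ... | a , gen , refl = subst (_∈ S) (sym (encode-⁻¹ a)) (generator⁻¹∈S gen)

  isCayleySet : IsCayleySet G S
  isCayleySet = record { e∉S = e∉S ; inv-clo = inv∈S }

  potential-generator : ∀ {a} → Generator a → ∀ b → potential (b ⊗ a) ≤ potential b + 1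
  potential-generator (move⁺ a) b = potential-move b (Fin.suc a)
  potential-generator (move⁻ a) b = potential-move⁻¹ b (Fin.suc a)
  potential-generator (turn⁺ j) b = potential-turn b (Fin.suc j)

  potential-edge : ∀ g s → s ∈ S → potential (decode (g · s)) ≤ potential (decode g) + 1
  potential-edge g s s∈S with ∈S⇒generator s∈S
  ... | a , gen , refl = begin
    potential (decode (g · encode a))
      ≡⟨ potential-cong (≈-trans (decode-· g (encode a)) (⊗-cong {a = decode g} ≈-refl (decode-encode a))) ⟩
    potential (decode g ⊗ a)           ≤⟨ potential-generator gen (decode g) ⟩
    potential (decode g) + 1           ∎
    where open ≤-Reasoning

  allLit : Lamp
  allLit = (λ _ → Fin.suc Fin.zero) , 𝟙

  potential-allLit : potential allLit ≡ suc N
  potential-allLit = trans (cong₂ _+_ (sum-const-1 N) (¬aligned⇒misaligned≡1 ¬aligned)) (+-comm N 1)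
    where
    ¬aligned : ¬ Aligned (proj₁ allLit) 𝟙
    ¬aligned (inj₁ below) = n≮n 1 (to (below 𝟙) (λ ()))
    ¬aligned (inj₂ above) with to (above 𝟘) (λ ())
    ... | ()

  potential-unit : potential unit ≡ 0
  potential-unit = cong₂ _+_ (sum-replicate-zero N) (aligned⇒misaligned≡0 (inj₁ nothing-lit))
    where
    nothing-lit : LitBelow (proj₁ unit) 𝟘
    nothing-lit i = mk⇔ (λ lit → ⊥-elim (lit refl)) (λ ())

  far-from-e : ¬ Dist≤ G S N (encode unit) (encode allLit)
  far-from-e (j , j≤N , w) = <-irrefl refl (begin-strict
    N                                     <⟨ n<1+n N ⟩
    suc N                                 ≡⟨ potential-allLit ⟨
    potential allLit                      ≡⟨ potential-cong (decode-encode allLit) ⟨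
    potential (decode (encode allLit))    ≤⟨ potential-walk (potential ∘ decode) potential-edge w ⟩
    potential (decode (encode unit)) + j  ≡⟨ cong (_+ j) (trans (potential-cong (decode-encode unit)) potential-unit) ⟩
    j                                     ≤⟨ j≤N ⟩
    N                                     ∎)
    where open ≤-Reasoning

  prefix : Config → ℕ → Config
  prefix v j i with toℕ i <? j
  ... | yes _ = v i
  ... | no _  = C.𝟘

  prefix-< : ∀ v {j} i → toℕ i < j → prefix v j i ≡ v i
  prefix-< v {j} i i<j with toℕ i <? j
  ... | yes _  = refl
  ... | no i≮j = ⊥-elim (i≮j i<j)

  prefix-≮ : ∀ v {j} i → ¬ toℕ i < j → prefix v j i ≡ C.𝟘
  prefix-≮ v {j} i i≮j with toℕ i <? j
  ... | yes i<j = ⊥-elim (i≮j i<j)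
  ... | no _    = refl

  prefix-cong : ∀ v {j j'} i → (toℕ i < j ⇔ toℕ i < j') → prefix v j i ≡ prefix v j' i
  prefix-cong v {j} {j'} i i<j⇔i<j' with toℕ i <? j
  ... | yes i<j = sym (prefix-< v i (to i<j⇔i<j' i<j))
  ... | no i≮j  = sym (prefix-≮ v i (i≮j ∘ from i<j⇔i<j'))

  stage : Config → ℕ → Lamp
  stage v j = prefix v j , j mod N

  stage-suc : ∀ v {j} → j < N → stage v j ⊗ move (v (j mod N)) ≈ stage v (suc j)
  stage-suc v {j} j<N = colours , P.mod-⊕𝟙 j
    where
    colours : ∀ i → proj₁ (stage v j ⊗ move (v (j mod N))) i ≡ prefix v (suc j) i
    colours i with i ≟ j mod N
    ... | yes refl = begin
      proj₁ (stage v j ⊗ move (v i)) i  ≡⟨ ⊗-atOrigin-here (prefix v j) i (v i) 𝟙 ⟩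
      prefix v j i C.⊕ v i              ≡⟨ cong (C._⊕ v i) (prefix-≮ v i (<-irrefl (P.toℕ-mod-< j<N))) ⟩
      C.𝟘 C.⊕ v i                       ≡⟨ C.⊕-identityˡ (v i) ⟩
      v i                               ≡⟨ prefix-< v i (s≤s (≤-reflexive (P.toℕ-mod-< j<N))) ⟨
      prefix v (suc j) i                ∎
      where open ≡-Reasoning
    ... | no i≢j = trans (⊗-atOrigin-elsewhere (prefix v j) (j mod N) (v (j mod N)) 𝟙 i i≢j)
                         (prefix-cong v i (m≢n⇒m<n⇔m<1+n toℕi≢j))
      where
      toℕi≢j : toℕ i ≢ j
      toℕi≢j toℕi≡j = i≢j (toℕ-injective (trans toℕi≡j (sym (P.toℕ-mod-< j<N))))

  walk-to-stage : ∀ v {j} → j ≤ N → Walk G S j (encode unit) (encode (stage v j))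
  walk-to-stage v {zero} _ =
    subst (Walk G S 0 (encode unit)) (encode-cong {unit} {stage v 0} (prefix-0 , refl)) (here _)
    where
    prefix-0 : ∀ i → C.𝟘 ≡ prefix v 0 i
    prefix-0 i = sym (prefix-≮ v {0} i λ ())
  walk-to-stage v {suc j} j<N =
    subst (Walk G S (suc j) (encode unit)) arrive (extend (walk-to-stage v (<⇒≤ j<N)) (move∈S (v (j mod N))))
    where
    arrive : encode (stage v j) · encode (move (v (j mod N))) ≡ encode (stage v (suc j))
    arrive = trans (encode-∙ (stage v j) (move (v (j mod N)))) (encode-cong (stage-suc v j<N))

  stage-N : ∀ v → stage v N ≈ (v , 𝟘)
  stage-N v = (λ i → prefix-< v i (toℕ<n i)) , toℕ-injective (trans (P.toℕ-mod N) (n%n≡0 N))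

  reachable-from-e : ∀ g → Dist≤ G S (suc N) (encode unit) g
  reachable-from-e g with proj₂ (decode g) ≟ 𝟘
  ... | yes p≡𝟘 = N , n≤1+n N , subst (Walk G S N (encode unit)) arrive (walk-to-stage v ≤-refl)
    where
    v = proj₁ (decode g)
    arrive : encode (stage v N) ≡ g
    arrive = trans (encode-cong (≈-trans (stage-N v) ((λ _ → refl) , sym p≡𝟘))) (encode-decode g)
  ... | no p≢𝟘 = suc N , ≤-refl ,
                 subst (Walk G S (suc N) (encode unit)) arrive (extend (walk-to-stage v ≤-refl) (turn∈S p≢𝟘))
    where
    v = proj₁ (decode g)
    p = proj₂ (decode g)
    arrive : encode (stage v N) · encode (turn p) ≡ g
    arrive = trans (encode-∙ (stage v N) (turn p))
                   (trans (encode-cong (≈-trans (⊗-cong {b = turn p} (stage-N v) ≈-refl)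
                                       (≈-trans (⊗-turn v 𝟘 p) ((λ _ → refl) , P.⊕-identityˡ p))))
                          (encode-decode g))

  hasDiameter : HasDiameter G S (suc N)
  hasDiameter = Dist≤-translate (suc N) reachable-from-e , encode unit , encode allLit , far-from-e

generators-budget : ∀ m j → suc (m / 2) + (suc (m / 2) + j) ≤ m + suc (suc j)
generators-budget m j = begin
  suc (m / 2) + (suc (m / 2) + j)  ≡⟨ double (m / 2) j ⟩
  m / 2 * 2 + suc (suc j)          ≤⟨ +-monoˡ-≤ (suc (suc j)) (m/n*n≤m m 2) ⟩
  m + suc (suc j)                  ∎
  where
  open ≤-Reasoning
  open +-*-Solver
  double : ∀ h j → suc h + (suc h + j) ≡ h * 2 + suc (suc j)
  double = solve 2 (λ h j → (con 1 :+ h) :+ ((con 1 :+ h) :+ j) := h :* con 2 :+ (con 2 :+ j)) refl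

theorem2 : ∀ (k d : ℕ) → 4 ≤ k → suc k ≤ d →
    ∃[ n ] Σ (FiniteGroup n) λ G → Σ (Subset n) λ S →
      IsCayleySet G S × HasDiameter G S k × ∣ S ∣ ≤ d ×
      n ≡ (k ∸ 1) * ((d ∸ k) / 2 + 2) ^ (k ∸ 1)
theorem2 k@(suc (suc (suc (suc t)))) d (s≤s (s≤s (s≤s (s≤s _)))) k<d =
  _ , G , S , isCayleySet , hasDiameter , ∣S∣≤d ,
  cong (λ m → suc (suc (suc t)) * m ^ suc (suc (suc t))) (+-comm 2 h)
  where
  h = (d ∸ k) / 2
  open LamplighterCayley (suc t) h
  ∣S∣≤d : ∣ S ∣ ≤ d
  ∣S∣≤d = begin
    ∣ S ∣                          ≤⟨ ∣S∣≤ ⟩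
    suc h + (suc h + suc (suc t))  ≤⟨ generators-budget (d ∸ k) (suc (suc t)) ⟩
    d ∸ k + k                      ≡⟨ m∸n+n≡m (<⇒≤ k<d) ⟩
    d                              ∎
    where open ≤-Reasoning
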